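{- Let $R\subseteq\mathbb N$ be a random set obtained by including each $n\in\mathbb N$ independently with probability $1/2$. Then, with probability $1$, $R$ is rich.
   Context: For $s$-dimensional vectors, $\bar a^{\top}\bar x=\sum_{j=1}^sa_jx_j$; $v+\mathbb N=\{v,v+1,\dots\}$. A set $R\subseteq\mathbb N$ is rich if for all $s,u,v\in\mathbb N$, all $\bar a_0\in\{0,1\}^s\setminus\{\bar0\}$, $\bar a_1,\dots,\bar a_u\in\mathbb N^s$ and all $c_1,\dots,c_u\in\mathbb N$ with $(\bar a_0,0)\ne(\bar a_i,c_i)$ for all $i\in\{1,\dots,u\}$, there exist $\bar x,\bar y\in(v+\mathbb N)^s$ such that $\bar a_0^{\top}\bar x\in R\iff\bar a_0^{\top}\bar y\notin R$, and $\bar a_i^{\top}\bar x-c_i\in R\iff\bar a_i^{\top}\bar y-c_i\in R$ for all $i\in\{1,\dots,u\}$. -}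

module Defs where

open import Data.Bool using (Bool; true; false; not; if_then_else_)
open import Data.Nat as ℕ using (ℕ; zero; suc; _∸_; _≤ᵇ_)
open import Data.Fin using (Fin)
open import Data.Vec using (Vec; []; _∷_; zipWith; sum; lookup; replicate)
open import Data.Vec.Relation.Unary.All using (All)
open import Data.List using (List; []; _∷_)
open import Data.Product using (Σ-syntax; ∃-syntax; _×_)
open import Data.Integer using (+_)
open import Data.Rational.Unnormalised using (ℚᵘ; mkℚᵘ; 1ℚᵘ; 0ℚᵘ) renaming (_+_ to _+q_; _*_ to _*q_)
open import Relation.Binary.PropositionalEquality using (_≡_)
open import Relation.Nullary using (¬_)

SubsetN : Set
SubsetN = ℕ → Bool

dot : ∀ {s} → Vec ℕ s → Vec ℕ s → ℕ
dot a x = sum (zipWith ℕ._*_ a x)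

-- Truth value of "m - c ∈ R" (an integer m - c < 0 is never in R ⊆ ℕ).
memShift : SubsetN → ℕ → ℕ → Bool
memShift R c m = if c ≤ᵇ m then R (m ∸ c) else false

Rich : SubsetN → Set
Rich R =
  ∀ (s u v : ℕ) (a₀ : Vec ℕ s) → All (ℕ._≤ 1) a₀ → ¬ (a₀ ≡ replicate s 0) →
  (as : Vec (Vec ℕ s) u) (cs : Vec ℕ u) →
  (∀ (i : Fin u) → ¬ (lookup as i ≡ a₀ × lookup cs i ≡ 0)) →
  ∃[ x ] ∃[ y ] (All (v ℕ.≤_) x × All (v ℕ.≤_) y ×
     R (dot a₀ x) ≡ not (R (dot a₀ y)) ×
     (∀ (i : Fin u) → memShift R (lookup cs i) (dot (lookup as i) x)
                    ≡ memShift R (lookup cs i) (dot (lookup as i) y)))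

-- Cantor-space (fair coin product measure) machinery.
-- A finite binary string w is a prefix of R: cylinder set [w].
Prefix : List Bool → SubsetN → Set
Prefix [] R = Data.Unit.⊤ where import Data.Unit
Prefix (b ∷ w) R = R 0 ≡ b × Prefix w (λ n → R (suc n))

-- 2^{-n} as an unnormalised rational; it is the measure of a cylinder of length n.
half : ℚᵘ
half = mkℚᵘ (+ 1) 1

pow2neg : ℕ → ℚᵘ
pow2neg zero = 1ℚᵘ
pow2neg (suc n) = half *q pow2neg n

len : List Bool → ℕ
len [] = 0
len (_ ∷ w) = suc (len w)

coverMass : (ℕ → List Bool) → ℕ → ℚᵘ
coverMass C zero = 0ℚᵘ
coverMass C (suc N) = coverMass C N +q pow2neg (len (C N))

module Submission where

-- Fix a bound n and a value α₀ ≤ n, and for a position L put N = n + 1 + L and M = (n + 1) N.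
-- Suppose R contains α₀N but none of the points αN − c and αM − c (1 ≤ α ≤ n, c ≤ n) other than
-- it. Then R passes every instance of the richness test with coefficients bounded by n and
-- a₀·w = α₀, where w = (1, B, B², …) for a base B exceeding all coefficients: take x = N·w and
-- y = M·w; the points differ because base-B digits are unique. The q points lie in a window
-- above L, so R fails to match in each of K disjoint windows with probability at most 1 − 2^-q,
-- independently, and (1 − 2^-q)^K ≤ 2^-e for K = 2^q e. Covering the failures of the m-th pair
-- (n, α₀) with e = k + m + 2 covers all non-rich sets with total mass at most 2^-k.

open import Algebra.Properties.CommutativeSemigroup using (interchange)
open import Data.Bool using (Bool; true; false; not; _∧_; if_then_else_; T) renaming (_≟_ to _≟ᵇ_)
open import Data.Bool.Properties using (T-∧; T-≡; T-not-≡; not-¬; ¬-not; not-injective)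
open import Data.Empty using (⊥-elim)
open import Data.Fin using (zero; suc)
import Data.Integer as ℤ
import Data.Integer.Properties as ℤP
open import Data.List as List using (List; []; _∷_; _++_; length; applyUpTo; upTo; cartesianProduct)
open import Data.List.Membership.Propositional using (_∈_)
open import Data.List.Membership.Propositional.Properties
  using (∈-++⁺ˡ; ∈-++⁺ʳ; ∈-++⁻; ∈-map⁺; ∈-map⁻; ∈-applyUpTo⁺; ∈-applyUpTo⁻; ∈-upTo⁺; ∈-upTo⁻;
         ∈-cartesianProduct⁺; ∈-cartesianProduct⁻)
open import Data.List.NonEmpty as List⁺ using (List⁺; _∷_)
open import Data.List.Properties using (length-map; length-++)
open import Data.List.Relation.Unary.All as All using (All; []; _∷_)
open import Data.List.Relation.Unary.All.Properties using (map⁺)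
open import Data.List.Relation.Unary.Any using (here; there)
open import Data.Nat
open import Data.Nat.Divisibility using (_∣_; ∣⇒≤; ∣m+n∣m⇒∣n; n∣m*n)
open import Data.Nat.DivMod using (_%_; [m+kn]%n≡m%n; m<n⇒m%n≡m)
open import Data.Nat.Properties
open import Data.Product using (Σ-syntax; ∃-syntax; _×_; _,_; proj₁; proj₂)
open import Data.Rational.Unnormalised as ℚ using (ℚᵘ; mkℚᵘ; 0ℚᵘ; *≡*; *≤*)
import Data.Rational.Unnormalised.Properties as ℚP
open import Data.Sum using (inj₁; inj₂)
open import Data.Vec as Vec using (Vec; []; _∷_; take; drop; lookup; replicate; toList)
open import Data.Vec.Properties using (lookup-map)
open import Data.Vec.Relation.Unary.All as VecAll using ([]; _∷_) renaming (All to VecAll)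
open import Function using (_∘_)
open import Function.Bundles using (Equivalence)
open import Relation.Binary.PropositionalEquality
open import Relation.Nullary using (¬_; Dec; yes; no; contradiction)
open import Relation.Nullary.Decidable using (⌊_⌋; toWitness; fromWitness; toWitnessFalse; fromWitnessFalse)

open import Defs

+-interchange : ∀ a b c d → (a + b) + (c + d) ≡ (a + c) + (b + d)
+-interchange = interchange +-commutativeSemigroup

*-interchange : ∀ a b c d → (a * b) * (c * d) ≡ (a * c) * (b * d)
*-interchange = interchange *-commutativeSemigroup

m+m≡2*m : ∀ m → m + m ≡ 2 * m
m+m≡2*m m = cong (m +_) (sym (+-identityʳ m))

^-distribʳ-* : ∀ x y e → (x * y) ^ e ≡ x ^ e * y ^ e
^-distribʳ-* x y zero    = refl
^-distribʳ-* x y (suc e) = trans (cong (x * y *_) (^-distribʳ-* x y e)) (*-interchange x y (x ^ e) (y ^ e))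

m*n∸o≡k*n⇒o≡0∧m≡k : ∀ m k {n o} .{{_ : NonZero n}} → o ≤ m * n → o < n →
                     m * n ∸ o ≡ k * n → o ≡ 0 × m ≡ k
m*n∸o≡k*n⇒o≡0∧m≡k m k {n} {zero}  _   _   eq = refl , *-cancelʳ-≡ m k n eq
m*n∸o≡k*n⇒o≡0∧m≡k m k {n} {suc o} o≤mn o<n eq = contradiction (∣⇒≤ n∣o) (<⇒≱ o<n)
  where
  n∣o : n ∣ suc o
  n∣o = ∣m+n∣m⇒∣n (subst (n ∣_) (sym (m∸n+n≡m o≤mn)) (n∣m*n m)) (subst (n ∣_) (sym eq) (n∣m*n k))

-- (1 + 1/b)^(n+1) ≥ 1 + (n+1)/b, with denominators cleared.
bernoulli : ∀ b n → b ^ n * (suc b + n) ≤ suc b ^ suc n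
bernoulli b zero = ≤-reflexive (trans (*-identityˡ (suc b + 0)) (trans (+-identityʳ (suc b)) (sym (*-identityʳ (suc b)))))
bernoulli b (suc n) = begin
  b ^ suc n * (suc b + suc n)           ≡⟨ cong (b ^ suc n *_) (+-suc (suc b) n) ⟩
  b ^ suc n * suc (suc b + n)           ≡⟨ *-suc (b ^ suc n) (suc b + n) ⟩
  b ^ suc n + b ^ suc n * (suc b + n)   ≡⟨ cong (b ^ suc n +_) (*-assoc b (b ^ n) (suc b + n)) ⟩
  b ^ suc n + b * (b ^ n * (suc b + n)) ≤⟨ +-mono-≤ (^-monoˡ-≤ (suc n) (n≤1+n b)) (*-monoʳ-≤ b (bernoulli b n)) ⟩
  suc b ^ suc n + b * suc b ^ suc n     ∎
  where open ≤-Reasoning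

n^[1+n]*2≤[1+n]^[1+n] : ∀ n → n ^ suc n * 2 ≤ suc n ^ suc n
n^[1+n]*2≤[1+n]^[1+n] n = *-cancelʳ-≤ (n ^ suc n * 2) (suc n ^ suc n) (suc n) (begin
  n ^ suc n * 2 * suc n        ≡⟨ *-assoc (n ^ suc n) 2 (suc n) ⟩
  n ^ suc n * (2 * suc n)      ≡⟨ cong (n ^ suc n *_) (m+m≡2*m (suc n)) ⟨
  n ^ suc n * (suc n + suc n)  ≤⟨ bernoulli n (suc n) ⟩
  suc n * suc n ^ suc n        ≡⟨ *-comm (suc n) (suc n ^ suc n) ⟩
  suc n ^ suc n * suc n        ∎)
  where open ≤-Reasoning

-- (1 - 1/m)^(m e) ≤ 2^-e, with denominators cleared.
[m∸1]^[m*e]*2^e≤m^[m*e] : ∀ m .{{_ : NonZero m}} e → (m ∸ 1) ^ (m * e) * 2 ^ e ≤ m ^ (m * e)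
[m∸1]^[m*e]*2^e≤m^[m*e] (suc n) e = begin
  n ^ (suc n * e) * 2 ^ e  ≡⟨ cong (_* 2 ^ e) (^-*-assoc n (suc n) e) ⟨
  (n ^ suc n) ^ e * 2 ^ e  ≡⟨ ^-distribʳ-* (n ^ suc n) 2 e ⟨
  (n ^ suc n * 2) ^ e      ≤⟨ ^-monoˡ-≤ e (n^[1+n]*2≤[1+n]^[1+n] n) ⟩
  (suc n ^ suc n) ^ e      ≡⟨ ^-*-assoc (suc n) (suc n) e ⟩
  suc n ^ (suc n * e)      ∎
  where open ≤-Reasoning

-- Counting binary strings

count : (ℓ : ℕ) → (Vec Bool ℓ → Bool) → ℕ
count zero    P = if P [] then 1 else 0
count (suc ℓ) P = count ℓ (P ∘ (false ∷_)) + count ℓ (P ∘ (true ∷_))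

count-mono : ∀ ℓ {P Q : Vec Bool ℓ → Bool} → (∀ w → T (P w) → T (Q w)) → count ℓ P ≤ count ℓ Q
count-mono zero {P} {Q} P⊆Q with P [] | Q [] | P⊆Q []
... | true  | true  | _   = ≤-refl
... | true  | false | P⇒Q = ⊥-elim (P⇒Q _)
... | false | _     | _   = z≤n
count-mono (suc ℓ) P⊆Q = +-mono-≤ (count-mono ℓ (P⊆Q ∘ (false ∷_))) (count-mono ℓ (P⊆Q ∘ (true ∷_)))

count-true : ∀ ℓ → count ℓ (λ _ → true) ≡ 2 ^ ℓ
count-true zero    = refl
count-true (suc ℓ) rewrite count-true ℓ | +-identityʳ (2 ^ ℓ) = refl

count-false : ∀ ℓ → count ℓ (λ _ → false) ≡ 0
count-false zero    = refl
count-false (suc ℓ) = cong₂ _+_ (count-false ℓ) (count-false ℓ)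

count-split : ∀ ℓ (P Q : Vec Bool ℓ → Bool) →
              count ℓ P ≡ count ℓ (λ w → P w ∧ Q w) + count ℓ (λ w → P w ∧ not (Q w))
count-split zero P Q with P [] | Q []
... | true  | true  = refl
... | true  | false = refl
... | false | _     = refl
count-split (suc ℓ) P Q =
  trans (cong₂ _+_ (count-split ℓ (P ∘ (false ∷_)) (Q ∘ (false ∷_)))
                   (count-split ℓ (P ∘ (true ∷_)) (Q ∘ (true ∷_))))
        (+-interchange (both false) (only false) (both true) (only true))
  where
  both only : Bool → ℕ
  both b = count ℓ (λ w → P (b ∷ w) ∧ Q (b ∷ w))
  only b = count ℓ (λ w → P (b ∷ w) ∧ not (Q (b ∷ w)))

count-not : ∀ ℓ (P : Vec Bool ℓ → Bool) → count ℓ P + count ℓ (not ∘ P) ≡ 2 ^ ℓ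
count-not ℓ P = begin
  count ℓ P + count ℓ (not ∘ P) ≡⟨ count-split ℓ (λ _ → true) P ⟨
  count ℓ (λ _ → true)          ≡⟨ count-true ℓ ⟩
  2 ^ ℓ                         ∎
  where open ≡-Reasoning

count-++ : ∀ a b (P : Vec Bool a → Bool) (Q : Vec Bool b → Bool) →
           count (a + b) (λ w → P (take a w) ∧ Q (drop a w)) ≡ count a P * count b Q
count-++ zero b P Q with P []
... | true  = sym (+-identityʳ (count b Q))
... | false = count-false b
count-++ (suc a) b P Q =
  trans (cong₂ _+_ (count-++ a b (P ∘ (false ∷_)) Q) (count-++ a b (P ∘ (true ∷_)) Q))
        (sym (*-distribʳ-+ (count b Q) (count a (P ∘ (false ∷_))) (count a (P ∘ (true ∷_)))))

satisfying : (ℓ : ℕ) → (Vec Bool ℓ → Bool) → List (Vec Bool ℓ)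
satisfying zero    P = if P [] then [] ∷ [] else []
satisfying (suc ℓ) P =
  List.map (false ∷_) (satisfying ℓ (P ∘ (false ∷_))) ++ List.map (true ∷_) (satisfying ℓ (P ∘ (true ∷_)))

length-satisfying : ∀ ℓ P → length (satisfying ℓ P) ≡ count ℓ P
length-satisfying zero P with P []
... | true  = refl
... | false = refl
length-satisfying (suc ℓ) P = begin
  length (List.map (false ∷_) (satisfying ℓ P₀) ++ List.map (true ∷_) (satisfying ℓ P₁))
    ≡⟨ length-++ (List.map (false ∷_) (satisfying ℓ P₀)) ⟩
  length (List.map (false ∷_) (satisfying ℓ P₀)) + length (List.map (true ∷_) (satisfying ℓ P₁))
    ≡⟨ cong₂ _+_ (length-map (false ∷_) (satisfying ℓ P₀)) (length-map (true ∷_) (satisfying ℓ P₁)) ⟩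
  length (satisfying ℓ P₀) + length (satisfying ℓ P₁)
    ≡⟨ cong₂ _+_ (length-satisfying ℓ P₀) (length-satisfying ℓ P₁) ⟩
  count (suc ℓ) P ∎
  where
  open ≡-Reasoning
  P₀ = P ∘ (false ∷_)
  P₁ = P ∘ (true ∷_)

∈-satisfying : ∀ ℓ P {w} → T (P w) → w ∈ satisfying ℓ P
∈-satisfying zero    P {[]} Pw with P []
... | true = here refl
∈-satisfying (suc ℓ) P {false ∷ w} Pw = ∈-++⁺ˡ (∈-map⁺ (false ∷_) (∈-satisfying ℓ (P ∘ (false ∷_)) Pw))
∈-satisfying (suc ℓ) P {true ∷ w}  Pw = ∈-++⁺ʳ _ (∈-map⁺ (true ∷_) (∈-satisfying ℓ (P ∘ (true ∷_)) Pw))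

bit : ∀ {ℓ} → Vec Bool ℓ → ℕ → Bool
bit []      _       = false
bit (b ∷ w) zero    = b
bit (b ∷ w) (suc j) = bit w j

flip : ∀ {ℓ} → ℕ → Vec Bool ℓ → Vec Bool ℓ
flip _       []      = []
flip zero    (b ∷ w) = not b ∷ w
flip (suc j) (b ∷ w) = b ∷ flip j w

bit-flip-≡ : ∀ {ℓ} j (w : Vec Bool ℓ) → j < ℓ → bit (flip j w) j ≡ not (bit w j)
bit-flip-≡ zero    (b ∷ w) _         = refl
bit-flip-≡ (suc j) (b ∷ w) (s≤s j<ℓ) = bit-flip-≡ j w j<ℓ

bit-flip-≢ : ∀ {ℓ} i j (w : Vec Bool ℓ) → i ≢ j → bit (flip j w) i ≡ bit w i
bit-flip-≢ _       _       []      _   = refl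
bit-flip-≢ zero    zero    (b ∷ w) i≢j = ⊥-elim (i≢j refl)
bit-flip-≢ (suc i) zero    (b ∷ w) _   = refl
bit-flip-≢ zero    (suc j) (b ∷ w) _   = refl
bit-flip-≢ (suc i) (suc j) (b ∷ w) i≢j = bit-flip-≢ i j w (i≢j ∘ cong suc)

count-∘-flip : ∀ ℓ j (P : Vec Bool ℓ → Bool) → count ℓ (P ∘ flip j) ≡ count ℓ P
count-∘-flip zero    j       P = refl
count-∘-flip (suc ℓ) zero    P = +-comm (count ℓ (P ∘ (true ∷_))) (count ℓ (P ∘ (false ∷_)))
count-∘-flip (suc ℓ) (suc j) P =
  cong₂ _+_ (count-∘-flip ℓ j (P ∘ (false ∷_))) (count-∘-flip ℓ j (P ∘ (true ∷_)))

agrees : ∀ {ℓ} → List ℕ → (ℕ → Bool) → Vec Bool ℓ → Bool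
agrees []       τ w = true
agrees (j ∷ js) τ w = agrees js τ w ∧ ⌊ bit w j ≟ᵇ τ j ⌋

agrees-∷⁻ : ∀ {ℓ} j js τ (w : Vec Bool ℓ) → T (agrees (j ∷ js) τ w) → T (agrees js τ w) × bit w j ≡ τ j
agrees-∷⁻ j js τ w h with Equivalence.to T-∧ h
... | rest , wⱼ≡τⱼ = rest , toWitness {a? = bit w j ≟ᵇ τ j} wⱼ≡τⱼ

agrees-∷⁺ : ∀ {ℓ} j js τ (w : Vec Bool ℓ) → T (agrees js τ w) → bit w j ≡ τ j → T (agrees (j ∷ js) τ w)
agrees-∷⁺ j js τ w rest wⱼ≡τⱼ = Equivalence.from T-∧ (rest , fromWitness wⱼ≡τⱼ)

agrees-flip : ∀ {ℓ} js τ j (w : Vec Bool ℓ) → j < ℓ → bit w j ≡ τ j →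
              T (agrees js τ (flip j w)) → T (agrees js τ w)
agrees-flip []       τ j w j<ℓ wⱼ≡τⱼ _ = _
agrees-flip (i ∷ is) τ j w j<ℓ wⱼ≡τⱼ h with agrees-∷⁻ i is τ (flip j w) h
... | rest , fᵢ≡τᵢ = agrees-∷⁺ i is τ w (agrees-flip is τ j w j<ℓ wⱼ≡τⱼ rest) (wᵢ≡τᵢ (i ≟ j))
  where
  wᵢ≡τᵢ : Dec (i ≡ j) → bit w i ≡ τ i
  wᵢ≡τᵢ (yes refl) = contradiction (trans (sym fᵢ≡τᵢ) (bit-flip-≡ j w j<ℓ)) (not-¬ (sym wⱼ≡τⱼ))
  wᵢ≡τᵢ (no i≢j)   = trans (sym (bit-flip-≢ i j w i≢j)) fᵢ≡τᵢ

-- Flipping bit j injects the strings that satisfy js but violate bit j into those satisfying j ∷ js.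
count-agrees-∷ : ∀ ℓ j js τ → j < ℓ → count ℓ (agrees js τ) ≤ count ℓ (agrees (j ∷ js) τ) * 2
count-agrees-∷ ℓ j js τ j<ℓ = begin
  count ℓ P                       ≡⟨ count-split ℓ P Q ⟩
  c + count ℓ P∧¬Q                ≡⟨ cong (c +_) (count-∘-flip ℓ j P∧¬Q) ⟨
  c + count ℓ (P∧¬Q ∘ flip j)     ≤⟨ +-monoʳ-≤ c (count-mono ℓ flipped) ⟩
  c + c                           ≡⟨ trans (m+m≡2*m c) (*-comm 2 c) ⟩
  c * 2                           ∎
  where
  c = count ℓ (agrees (j ∷ js) τ)
  open ≤-Reasoning
  P Q P∧¬Q : Vec Bool ℓ → Bool
  P = agrees js τ
  Q w = ⌊ bit w j ≟ᵇ τ j ⌋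
  P∧¬Q w = P w ∧ not (Q w)
  flipped : ∀ w → T (P∧¬Q (flip j w)) → T (agrees (j ∷ js) τ w)
  flipped w h with Equivalence.to T-∧ h
  ... | Pf , ¬Qf = agrees-∷⁺ j js τ w (agrees-flip js τ j w j<ℓ wⱼ≡τⱼ Pf) wⱼ≡τⱼ
    where
    wⱼ≡τⱼ : bit w j ≡ τ j
    wⱼ≡τⱼ = not-injective (¬-not (toWitnessFalse ¬Qf ∘ trans (bit-flip-≡ j w j<ℓ)))

count-agrees : ∀ ℓ js τ → All (_< ℓ) js → 2 ^ ℓ ≤ count ℓ (agrees js τ) * 2 ^ length js
count-agrees ℓ [] τ [] = ≤-reflexive (trans (sym (count-true ℓ)) (sym (*-identityʳ _)))
count-agrees ℓ (j ∷ js) τ (j<ℓ ∷ js<ℓ) = begin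
  2 ^ ℓ                                            ≤⟨ count-agrees ℓ js τ js<ℓ ⟩
  count ℓ (agrees js τ) * 2 ^ length js            ≤⟨ *-monoˡ-≤ (2 ^ length js) (count-agrees-∷ ℓ j js τ j<ℓ) ⟩
  count ℓ (agrees (j ∷ js) τ) * 2 * 2 ^ length js  ≡⟨ *-assoc (count ℓ (agrees (j ∷ js) τ)) 2 (2 ^ length js) ⟩
  count ℓ (agrees (j ∷ js) τ) * 2 ^ length (j ∷ js) ∎
  where open ≤-Reasoning

agrees⇒All : ∀ {ℓ} js τ (w : Vec Bool ℓ) → T (agrees js τ w) → All (λ j → bit w j ≡ τ j) js
agrees⇒All []       τ w _ = []
agrees⇒All (j ∷ js) τ w h with agrees-∷⁻ j js τ w h
... | rest , wⱼ≡τⱼ = wⱼ≡τⱼ ∷ agrees⇒All js τ w rest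

-- Independent trials

prefix : (ℓ : ℕ) → (ℕ → Bool) → Vec Bool ℓ
prefix zero    R = []
prefix (suc ℓ) R = R 0 ∷ prefix ℓ (R ∘ suc)

take-prefix : ∀ a b R → take a (prefix (a + b) R) ≡ prefix a R
take-prefix zero    b R = refl
take-prefix (suc a) b R = cong (R 0 ∷_) (take-prefix a b (R ∘ suc))

drop-prefix : ∀ a b R → drop a (prefix (a + b) R) ≡ prefix b (R ∘ (a +_))
drop-prefix zero    b R = refl
drop-prefix (suc a) b R = drop-prefix a b (R ∘ suc)

bit-prefix : ∀ ℓ R j → j < ℓ → bit (prefix ℓ R) j ≡ R j
bit-prefix (suc ℓ) R zero    _         = refl
bit-prefix (suc ℓ) R (suc j) (s≤s j<ℓ) = bit-prefix ℓ (R ∘ suc) j j<ℓ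

Prefix-prefix : ∀ ℓ R → Prefix (toList (prefix ℓ R)) R
Prefix-prefix zero    R = _
Prefix-prefix (suc ℓ) R = refl , Prefix-prefix ℓ (R ∘ suc)

module Repetition (ℓ : ℕ → ℕ) (Success : (L : ℕ) → Vec Bool (ℓ L) → Bool) (q : ℕ)
                  (count-Success : ∀ L → 2 ^ ℓ L ≤ count (ℓ L) (Success L) * 2 ^ q) where

  offset : ℕ → ℕ
  offset zero    = 0
  offset (suc t) = offset t + ℓ (offset t)

  block : ∀ t → (ℕ → Bool) → Vec Bool (ℓ (offset t))
  block t R = prefix (ℓ (offset t)) (R ∘ (offset t +_))

  AllFail : (t : ℕ) → Vec Bool (offset t) → Bool
  AllFail zero    _ = true
  AllFail (suc t) w = AllFail t (take (offset t) w) ∧ not (Success (offset t) (drop (offset t) w))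

  count-failure : ∀ L → count (ℓ L) (not ∘ Success L) * 2 ^ q ≤ 2 ^ ℓ L * (2 ^ q ∸ 1)
  count-failure L = begin
    failures * 2 ^ q               ≤⟨ m+n≤o⇒m≤o∸n (failures * 2 ^ q) all≤ ⟩
    2 ^ ℓ L * 2 ^ q ∸ 2 ^ ℓ L      ≡⟨ cong (2 ^ ℓ L * 2 ^ q ∸_) (*-identityʳ (2 ^ ℓ L)) ⟨
    2 ^ ℓ L * 2 ^ q ∸ 2 ^ ℓ L * 1  ≡⟨ *-distribˡ-∸ (2 ^ ℓ L) (2 ^ q) 1 ⟨
    2 ^ ℓ L * (2 ^ q ∸ 1)          ∎
    where
    open ≤-Reasoning
    failures = count (ℓ L) (not ∘ Success L)
    all≤ : failures * 2 ^ q + 2 ^ ℓ L ≤ 2 ^ ℓ L * 2 ^ q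
    all≤ = begin
      failures * 2 ^ q + 2 ^ ℓ L                             ≤⟨ +-monoʳ-≤ (failures * 2 ^ q) (count-Success L) ⟩
      failures * 2 ^ q + count (ℓ L) (Success L) * 2 ^ q     ≡⟨ *-distribʳ-+ (2 ^ q) failures _ ⟨
      (failures + count (ℓ L) (Success L)) * 2 ^ q           ≡⟨ cong (_* 2 ^ q) (trans (+-comm failures _) (count-not (ℓ L) (Success L))) ⟩
      2 ^ ℓ L * 2 ^ q                                        ∎

  count-AllFail : ∀ t → count (offset t) (AllFail t) * (2 ^ q) ^ t ≤ 2 ^ offset t * (2 ^ q ∸ 1) ^ t
  count-AllFail zero    = ≤-refl
  count-AllFail (suc t) = begin
    count (offset t + ℓ (offset t)) (AllFail (suc t)) * (2 ^ q * (2 ^ q) ^ t)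
      ≡⟨ cong (_* (2 ^ q * (2 ^ q) ^ t)) (count-++ (offset t) (ℓ (offset t)) (AllFail t) (not ∘ Success (offset t))) ⟩
    (earlier * now) * (2 ^ q * (2 ^ q) ^ t)
      ≡⟨ trans (cong ((earlier * now) *_) (*-comm (2 ^ q) _)) (*-interchange earlier now _ (2 ^ q)) ⟩
    (earlier * (2 ^ q) ^ t) * (now * 2 ^ q)
      ≤⟨ *-mono-≤ (count-AllFail t) (count-failure (offset t)) ⟩
    (2 ^ offset t * (2 ^ q ∸ 1) ^ t) * (2 ^ ℓ (offset t) * (2 ^ q ∸ 1))
      ≡⟨ *-interchange (2 ^ offset t) _ (2 ^ ℓ (offset t)) _ ⟩
    (2 ^ offset t * 2 ^ ℓ (offset t)) * ((2 ^ q ∸ 1) ^ t * (2 ^ q ∸ 1))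
      ≡⟨ cong₂ _*_ (^-distribˡ-+-* 2 (offset t) (ℓ (offset t))) (*-comm (2 ^ q ∸ 1) _) ⟨
    2 ^ offset (suc t) * (2 ^ q ∸ 1) ^ suc t ∎
    where
    open ≤-Reasoning
    earlier = count (offset t) (AllFail t)
    now = count (ℓ (offset t)) (not ∘ Success (offset t))

  count-AllFail-2^q*e : ∀ e → count (offset (2 ^ q * e)) (AllFail (2 ^ q * e)) * 2 ^ e ≤ 2 ^ offset (2 ^ q * e)
  count-AllFail-2^q*e e = *-cancelʳ-≤ _ _ (Q ^ K) {{m^n≢0 Q K}} (begin
    c * 2 ^ e * Q ^ K              ≡⟨ trans (*-assoc c _ _) (trans (cong (c *_) (*-comm (2 ^ e) _)) (sym (*-assoc c _ _))) ⟩
    c * Q ^ K * 2 ^ e              ≤⟨ *-monoˡ-≤ (2 ^ e) (count-AllFail K) ⟩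
    2 ^ offset K * (Q ∸ 1) ^ K * 2 ^ e ≡⟨ *-assoc (2 ^ offset K) _ _ ⟩
    2 ^ offset K * ((Q ∸ 1) ^ K * 2 ^ e) ≤⟨ *-monoʳ-≤ (2 ^ offset K) ([m∸1]^[m*e]*2^e≤m^[m*e] Q e) ⟩
    2 ^ offset K * Q ^ K           ∎)
    where
    open ≤-Reasoning
    Q = 2 ^ q
    instance Q≢0 : NonZero Q
    Q≢0 = m^n≢0 2 q
    K = Q * e
    c = count (offset K) (AllFail K)

  ¬AllFail⇒Success : ∀ t R → ¬ T (AllFail t (prefix (offset t) R)) → ∃[ s ] T (Success (offset s) (block s R))
  ¬AllFail⇒Success zero    R fails = contradiction _ fails
  ¬AllFail⇒Success (suc t) R fails
    rewrite take-prefix (offset t) (ℓ (offset t)) R | drop-prefix (offset t) (ℓ (offset t)) R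
    with AllFail t (prefix (offset t) R) in earlier | Success (offset t) (block t R) in now
  ... | false | _     = ¬AllFail⇒Success t R (subst T earlier)
  ... | true  | true  = t , subst T (sym now) _
  ... | true  | false = contradiction _ fails

dot-scale : ∀ {s} (a w : Vec ℕ s) X → dot a (Vec.map (_* X) w) ≡ dot a w * X
dot-scale []       []       X = refl
dot-scale (aᵢ ∷ a) (wᵢ ∷ w) X = begin
  aᵢ * (wᵢ * X) + dot a (Vec.map (_* X) w) ≡⟨ cong₂ _+_ (*-assoc aᵢ wᵢ X) (sym (dot-scale a w X)) ⟨
  aᵢ * wᵢ * X + dot a w * X                ≡⟨ *-distribʳ-+ X (aᵢ * wᵢ) (dot a w) ⟨
  (aᵢ * wᵢ + dot a w) * X                  ∎
  where open ≡-Reasoning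

dot-positive : ∀ {s} (a w : Vec ℕ s) → VecAll (1 ≤_) w → a ≢ replicate s 0 → 1 ≤ dot a w
dot-positive []          []       _            a≢0 = contradiction refl a≢0
dot-positive (zero  ∷ a) (wᵢ ∷ w) (_ ∷ 1≤w)    a≢0 = dot-positive a w 1≤w (a≢0 ∘ cong (0 ∷_))
dot-positive (suc aᵢ ∷ a) (wᵢ ∷ w) (1≤wᵢ ∷ _) _   =
  ≤-trans 1≤wᵢ (≤-trans (m≤m+n wᵢ (aᵢ * wᵢ)) (m≤m+n _ (dot a w)))

scaled-≥ : ∀ {s v X} {w : Vec ℕ s} → VecAll (1 ≤_) w → v ≤ X → VecAll (v ≤_) (Vec.map (_* X) w)
scaled-≥             []           _   = []
scaled-≥ {X = X} {wᵢ ∷ _} (1≤wᵢ ∷ 1≤w) v≤X =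
  ≤-trans v≤X (m≤n*m X wᵢ {{>-nonZero 1≤wᵢ}}) ∷ scaled-≥ 1≤w v≤X

powers : (s B : ℕ) → Vec ℕ s
powers zero    B = []
powers (suc s) B = 1 ∷ Vec.map (_* B) (powers s B)

powers-positive : ∀ s {B} → 1 ≤ B → VecAll (1 ≤_) (powers s B)
powers-positive zero    _   = []
powers-positive (suc s) 1≤B = z<s ∷ scaled-≥ (powers-positive s 1≤B) 1≤B

digits-unique : ∀ {B x y X Y} → x < B → y < B → x + X * B ≡ y + Y * B → x ≡ y × X ≡ Y
digits-unique {B} {x} {y} {X} {Y} x<B y<B eq =
  x≡y , *-cancelʳ-≡ X Y B (+-cancelˡ-≡ x _ _ (trans eq (cong (_+ Y * B) (sym x≡y))))
  where
  instance B≢0 : NonZero B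
  B≢0 = >-nonZero (≤-<-trans z≤n x<B)
  open ≡-Reasoning
  x≡y : x ≡ y
  x≡y = begin
    x                ≡⟨ m<n⇒m%n≡m x<B ⟨
    x % B            ≡⟨ [m+kn]%n≡m%n x X B ⟨
    (x + X * B) % B  ≡⟨ cong (_% B) eq ⟩
    (y + Y * B) % B  ≡⟨ [m+kn]%n≡m%n y Y B ⟩
    y % B            ≡⟨ m<n⇒m%n≡m y<B ⟩
    y                ∎

dot-powers-∷ : ∀ {s B} xᵢ (x : Vec ℕ s) → dot (xᵢ ∷ x) (powers (suc s) B) ≡ xᵢ + dot x (powers s B) * B
dot-powers-∷ {s} {B} xᵢ x = cong₂ _+_ (*-identityʳ xᵢ) (dot-scale x (powers s B) B)

dot-powers-injective : ∀ s B (x y : Vec ℕ s) → VecAll (_< B) x → VecAll (_< B) y →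
                       dot x (powers s B) ≡ dot y (powers s B) → x ≡ y
dot-powers-injective zero    B []       []       _            _            _  = refl
dot-powers-injective (suc s) B (xᵢ ∷ x) (yᵢ ∷ y) (xᵢ<B ∷ x<B) (yᵢ<B ∷ y<B) eq
  with xᵢ≡yᵢ , rest ← digits-unique xᵢ<B yᵢ<B (trans (sym (dot-powers-∷ xᵢ x)) (trans eq (dot-powers-∷ yᵢ y))) =
  cong₂ _∷_ xᵢ≡yᵢ (dot-powers-injective s B x y x<B y<B rest)

lookup≤sum : ∀ {u} (x : Vec ℕ u) i → lookup x i ≤ Vec.sum x
lookup≤sum (xᵢ ∷ x) zero    = m≤m+n xᵢ (Vec.sum x)
lookup≤sum (xᵢ ∷ x) (suc i) = ≤-trans (lookup≤sum x i) (m≤n+m (Vec.sum x) xᵢ)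

entries≤sum : ∀ {s} (x : Vec ℕ s) → VecAll (_≤ Vec.sum x) x
entries≤sum []       = []
entries≤sum (xᵢ ∷ x) = m≤m+n xᵢ (Vec.sum x) ∷ VecAll.map (λ le → ≤-trans le (m≤n+m (Vec.sum x) xᵢ)) (entries≤sum x)

base : ∀ {s u} → Vec (Vec ℕ s) u → ℕ
base as = 2 + Vec.sum (Vec.map Vec.sum as)

powers-separate : ∀ {s u} (a₀ : Vec ℕ s) (as : Vec (Vec ℕ s) u) → VecAll (_≤ 1) a₀ → ∀ i →
                  dot (lookup as i) (powers s (base as)) ≡ dot a₀ (powers s (base as)) → lookup as i ≡ a₀
powers-separate {s} a₀ as a₀≤1 i = dot-powers-injective s (base as) (lookup as i) a₀ aᵢ<B a₀<B
  where
  a₀<B = VecAll.map (λ aⱼ≤1 → s≤s (≤-trans aⱼ≤1 (s≤s z≤n))) a₀≤1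
  sumᵢ≤ : Vec.sum (lookup as i) ≤ Vec.sum (Vec.map Vec.sum as)
  sumᵢ≤ = subst (_≤ _) (lookup-map i Vec.sum as) (lookup≤sum (Vec.map Vec.sum as) i)
  aᵢ<B = VecAll.map (λ aᵢⱼ≤ → s≤s (≤-trans aᵢⱼ≤ (≤-trans sumᵢ≤ (n≤1+n _)))) (entries≤sum (lookup as i))

memShift-≤ : ∀ R {c X} → c ≤ X → memShift R c X ≡ R (X ∸ c)
memShift-≤ R c≤X rewrite Equivalence.to T-≡ (≤⇒≤ᵇ c≤X) = refl

-- The points are the values αX − c (1 ≤ α ≤ n, c ≤ n) that a form aᵢ·x − cᵢ with aᵢ·w = α takes at
-- x = X·w for X = N L and X = M L; R matches at L if it contains α₀ N L and no other point.
module TestPattern (n a : ℕ) where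

  α₀ : ℕ
  α₀ = suc a

  N M : ℕ → ℕ
  N L = n + suc L
  M L = suc n * N L

  grid : List (ℕ × ℕ)
  grid = cartesianProduct (applyUpTo suc n) (upTo (suc n))

  multiples : ℕ → List ℕ
  multiples X = List.map (λ (α , c) → α * X ∸ c) grid

  points : ℕ → List ℕ
  points L = α₀ * N L ∷ multiples (N L) ++ multiples (M L)

  target : ℕ → ℕ → Bool
  target L x = ⌊ x ≟ α₀ * N L ⌋

  Matches : (ℕ → Bool) → ℕ → Set
  Matches R L = ∀ {x} → x ∈ points L → R x ≡ target L x

  ∈-grid⁺ : ∀ {α c} → 1 ≤ α → α ≤ n → c ≤ n → (α , c) ∈ grid
  ∈-grid⁺ {suc α} _ α<n c≤n = ∈-cartesianProduct⁺ (∈-applyUpTo⁺ suc α<n) (∈-upTo⁺ (s≤s c≤n))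

  ∈-grid⁻ : ∀ {α c} → (α , c) ∈ grid → 1 ≤ α × α ≤ n × c ≤ n
  ∈-grid⁻ p with α∈ , c∈ ← ∈-cartesianProduct⁻ (applyUpTo suc n) (upTo (suc n)) p
             with i , i<n , refl ← ∈-applyUpTo⁻ suc α∈ = s≤s z≤n , i<n , s≤s⁻¹ (∈-upTo⁻ c∈)

  n<N : ∀ L → n < N L
  n<N L = m<m+n n z<s

  L<N∸n : ∀ L → L < N L ∸ n
  L<N∸n L = ≤-reflexive (sym (m+n∸m≡n n (suc L)))

  multiples-bounds : ∀ L {X x} → N L ≤ X → x ∈ multiples X → L ≤ x × x ≤ n * X
  multiples-bounds L {X} N≤X x∈ with (α , c) , p , refl ← ∈-map⁻ _ x∈
                                 with 1≤α , α≤n , c≤n ← ∈-grid⁻ p =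
    <⇒≤ (begin-strict
      L           <⟨ L<N∸n L ⟩
      N L ∸ n     ≤⟨ ∸-mono N≤X c≤n ⟩
      X ∸ c       ≤⟨ ∸-monoˡ-≤ c (m≤n*m X α {{>-nonZero 1≤α}}) ⟩
      α * X ∸ c   ∎) ,
    ≤-trans (m∸n≤m (α * X) c) (*-monoˡ-≤ X α≤n)
    where open ≤-Reasoning

  N≤M : ∀ L → N L ≤ M L
  N≤M L = m≤n*m (N L) (suc n)

  Matches-α₀N : ∀ {R L} → Matches R L → R (α₀ * N L) ≡ true
  Matches-α₀N matches = trans (matches (here refl)) (Equivalence.to T-≡ (fromWitness refl))

  Matches-≢ : ∀ {R L x} → Matches R L → x ∈ points L → x ≢ α₀ * N L → R x ≡ false
  Matches-≢ matches x∈ x≢α₀N = trans (matches x∈) (Equivalence.to T-not-≡ (fromWitnessFalse x≢α₀N))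

  ∈-points-N : ∀ L {α c} → 1 ≤ α → α ≤ n → c ≤ n → α * N L ∸ c ∈ points L
  ∈-points-N L 1≤α α≤n c≤n = there (∈-++⁺ˡ (∈-map⁺ _ (∈-grid⁺ 1≤α α≤n c≤n)))

  ∈-points-M : ∀ L {α c} → 1 ≤ α → α ≤ n → c ≤ n → α * M L ∸ c ∈ points L
  ∈-points-M L 1≤α α≤n c≤n = there (∈-++⁺ʳ (multiples (N L)) (∈-map⁺ _ (∈-grid⁺ 1≤α α≤n c≤n)))

  α₀N<αM∸c : ∀ L {α c} → α₀ ≤ n → 1 ≤ α → c ≤ n → α₀ * N L < α * M L ∸ c
  α₀N<αM∸c L {α} {c} α₀≤n 1≤α c≤n = m+n≤o⇒m≤o∸n (suc (α₀ * N L)) (begin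
    suc (α₀ * N L) + c   ≤⟨ +-mono-≤ (s≤s (*-monoˡ-≤ (N L) α₀≤n)) c≤n ⟩
    suc (n * N L) + n    ≡⟨ +-suc (n * N L) n ⟨
    n * N L + suc n      ≤⟨ +-monoʳ-≤ (n * N L) (n<N L) ⟩
    n * N L + N L        ≡⟨ +-comm (n * N L) (N L) ⟩
    M L                  ≤⟨ m≤n*m (M L) α {{>-nonZero 1≤α}} ⟩
    α * M L              ∎)
    where open ≤-Reasoning

  Matches-separates : ∀ {R L} → Matches R L → α₀ ≤ n → R (α₀ * N L) ≡ not (R (α₀ * M L))
  Matches-separates {R} {L} matches α₀≤n = begin
    R (α₀ * N L)        ≡⟨ Matches-α₀N matches ⟩
    not false           ≡⟨ cong not (Matches-≢ matches (∈-points-M L z<s α₀≤n z≤n) (>⇒≢ (α₀N<αM∸c L {α₀} α₀≤n z<s z≤n))) ⟨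
    not (R (α₀ * M L))  ∎
    where open ≡-Reasoning

  Matches-memShift : ∀ {R L α c} → Matches R L → α₀ ≤ n → α ≤ n → c ≤ n → ¬ (α ≡ α₀ × c ≡ 0) →
                     memShift R c (α * N L) ≡ memShift R c (α * M L)
  Matches-memShift {α = zero} _ _ _ _ _ = refl
  Matches-memShift {R} {L} {α@(suc _)} {c} matches α₀≤n α≤n c≤n not-α₀ = begin
    memShift R c (α * N L) ≡⟨ memShift-≤ R c≤αN ⟩
    R (α * N L ∸ c)        ≡⟨ Matches-≢ matches (∈-points-N L z<s α≤n c≤n) αN∸c≢α₀N ⟩
    false                  ≡⟨ Matches-≢ matches (∈-points-M L z<s α≤n c≤n) (>⇒≢ (α₀N<αM∸c L {α} α₀≤n z<s c≤n)) ⟨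
    R (α * M L ∸ c)        ≡⟨ memShift-≤ R (≤-trans c≤αN αN≤αM) ⟨
    memShift R c (α * M L) ∎
    where
    open ≡-Reasoning
    c<N = ≤-<-trans c≤n (n<N L)
    c≤αN = ≤-trans (<⇒≤ c<N) (m≤n*m (N L) α {{>-nonZero z<s}})
    αN≤αM : α * N L ≤ α * M L
    αN≤αM = *-monoʳ-≤ α (N≤M L)
    αN∸c≢α₀N : α * N L ∸ c ≢ α₀ * N L
    αN∸c≢α₀N eq with c≡0 , α≡α₀ ← m*n∸o≡k*n⇒o≡0∧m≡k α α₀ {{>-nonZero (≤-<-trans z≤n (n<N L))}} c≤αN c<N eq =
      not-α₀ (α≡α₀ , c≡0)

  width : ℕ → ℕ
  width L = suc ((n + α₀) * M L)

  points-bounds : ∀ L {x} → x ∈ points L → L ≤ x × x < width L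
  points-bounds L (here refl) =
    ≤-trans (≤-trans (n≤1+n L) (m≤n+m (suc L) n)) (m≤n*m (N L) α₀) ,
    s≤s (≤-trans (*-monoʳ-≤ α₀ (N≤M L)) (*-monoˡ-≤ (M L) (m≤n+m α₀ n)))
  points-bounds L (there x∈) with ∈-++⁻ (multiples (N L)) x∈
  ... | inj₁ x∈N with L≤x , x≤nN ← multiples-bounds L ≤-refl x∈N =
    L≤x , s≤s (≤-trans x≤nN (≤-trans (*-monoʳ-≤ n (N≤M L)) (*-monoˡ-≤ (M L) (m≤m+n n α₀))))
  ... | inj₂ x∈M with L≤x , x≤nM ← multiples-bounds L (N≤M L) x∈M =
    L≤x , s≤s (≤-trans x≤nM (*-monoˡ-≤ (M L) (m≤m+n n α₀)))

  q : ℕ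
  q = suc (length grid + length grid)

  offsets : ℕ → List ℕ
  offsets L = List.map (_∸ L) (points L)

  length-offsets : ∀ L → length (offsets L) ≡ q
  length-offsets L = begin
    length (offsets L)                                      ≡⟨ length-map (_∸ L) (points L) ⟩
    suc (length (multiples (N L) ++ multiples (M L)))       ≡⟨ cong suc (length-++ (multiples (N L))) ⟩
    suc (length (multiples (N L)) + length (multiples (M L))) ≡⟨ cong suc (cong₂ _+_ (length-map _ grid) (length-map _ grid)) ⟩
    q                                                       ∎
    where open ≡-Reasoning

  Success : (L : ℕ) → Vec Bool (width L) → Bool
  Success L = agrees (offsets L) (target L ∘ (L +_))

  count-Success : ∀ L → 2 ^ width L ≤ count (width L) (Success L) * 2 ^ q
  count-Success L = subst (λ k → 2 ^ width L ≤ count (width L) (Success L) * 2 ^ k) (length-offsets L)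
    (count-agrees (width L) (offsets L) (target L ∘ (L +_))
      (map⁺ (All.tabulate λ x∈ → ≤-<-trans (m∸n≤m _ L) (proj₂ (points-bounds L x∈)))))

  Success⇒Matches : ∀ L R → T (Success L (prefix (width L) (R ∘ (L +_)))) → Matches R L
  Success⇒Matches L R success {x} x∈ = begin
    R x                                            ≡⟨ cong R L+[x∸L]≡x ⟨
    R (L + (x ∸ L))                                ≡⟨ bit-prefix (width L) (R ∘ (L +_)) (x ∸ L) x∸L<width ⟨
    bit (prefix (width L) (R ∘ (L +_))) (x ∸ L)    ≡⟨ All.lookup (agrees⇒All (offsets L) _ _ success) (∈-map⁺ (_∸ L) x∈) ⟩
    target L (L + (x ∸ L))                         ≡⟨ cong (target L) L+[x∸L]≡x ⟩
    target L x                                     ∎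
    where
    open ≡-Reasoning
    L+[x∸L]≡x = m+[n∸m]≡n (proj₁ (points-bounds L x∈))
    x∸L<width = ≤-<-trans (m∸n≤m x L) (proj₂ (points-bounds L x∈))

patterns⇒Rich : ∀ R → (∀ n a → ∃[ L ] TestPattern.Matches n a R L) → Rich R
patterns⇒Rich R matched s u v a₀ a₀≤1 a₀≢0 as cs distinct =
  Vec.map (_* N L) w , Vec.map (_* M L) w , scaled-≥ w≥1 v≤N , scaled-≥ w≥1 (≤-trans v≤N (N≤M L)) ,
  a₀-separates , aᵢ-agrees
  where
  w = powers s (base as)
  w≥1 = powers-positive s {base as} (s≤s z≤n)
  αs = Vec.map (λ aᵢ → dot aᵢ w) as
  n = v + dot a₀ w + Vec.sum αs + Vec.sum cs
  open TestPattern n (pred (dot a₀ w))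

  dot-a₀≡α₀ : dot a₀ w ≡ α₀
  dot-a₀≡α₀ = sym (suc-pred (dot a₀ w) {{>-nonZero (dot-positive a₀ w w≥1 a₀≢0)}})

  L = proj₁ (matched n (pred (dot a₀ w)))
  matches = proj₂ (matched n (pred (dot a₀ w)))

  v≤N : v ≤ N L
  v≤N = ≤-trans (≤-trans (m≤m+n v _) (≤-trans (m≤m+n _ (Vec.sum αs)) (m≤m+n _ (Vec.sum cs)))) (<⇒≤ (n<N L))

  α₀≤n : α₀ ≤ n
  α₀≤n = subst (_≤ n) dot-a₀≡α₀ (≤-trans (m≤n+m _ v) (≤-trans (m≤m+n _ (Vec.sum αs)) (m≤m+n _ (Vec.sum cs))))

  αᵢ≤n : ∀ i → dot (lookup as i) w ≤ n
  αᵢ≤n i = subst (_≤ n) (lookup-map i (λ aᵢ → dot aᵢ w) as)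
    (≤-trans (lookup≤sum αs i) (≤-trans (m≤n+m (Vec.sum αs) _) (m≤m+n _ (Vec.sum cs))))

  cᵢ≤n : ∀ i → lookup cs i ≤ n
  cᵢ≤n i = ≤-trans (lookup≤sum cs i) (m≤n+m (Vec.sum cs) _)

  a₀·scaled : ∀ X → dot a₀ (Vec.map (_* X) w) ≡ α₀ * X
  a₀·scaled X = trans (dot-scale a₀ w X) (cong (_* X) dot-a₀≡α₀)

  a₀-separates : R (dot a₀ (Vec.map (_* N L) w)) ≡ not (R (dot a₀ (Vec.map (_* M L) w)))
  a₀-separates = trans (cong R (a₀·scaled (N L)))
                       (trans (Matches-separates matches α₀≤n) (cong (not ∘ R) (sym (a₀·scaled (M L)))))

  not-α₀ : ∀ i → ¬ (dot (lookup as i) w ≡ α₀ × lookup cs i ≡ 0)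
  not-α₀ i (αᵢ≡α₀ , cᵢ≡0) =
    distinct i (powers-separate a₀ as a₀≤1 i (trans αᵢ≡α₀ (sym dot-a₀≡α₀)) , cᵢ≡0)

  aᵢ-agrees : ∀ i → memShift R (lookup cs i) (dot (lookup as i) (Vec.map (_* N L) w))
                  ≡ memShift R (lookup cs i) (dot (lookup as i) (Vec.map (_* M L) w))
  aᵢ-agrees i = begin
    memShift R cᵢ (dot aᵢ (Vec.map (_* N L) w)) ≡⟨ cong (memShift R cᵢ) (dot-scale aᵢ w (N L)) ⟩
    memShift R cᵢ (dot aᵢ w * N L)              ≡⟨ Matches-memShift matches α₀≤n (αᵢ≤n i) (cᵢ≤n i) (not-α₀ i) ⟩
    memShift R cᵢ (dot aᵢ w * M L)              ≡⟨ cong (memShift R cᵢ) (dot-scale aᵢ w (M L)) ⟨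
    memShift R cᵢ (dot aᵢ (Vec.map (_* M L) w)) ∎
    where
    open ≡-Reasoning
    aᵢ = lookup as i
    cᵢ = lookup cs i

-- Dyadic masses

-- mkℚᵘ p d stands for p / (d + 1).
_/2^_ : ℕ → ℕ → ℚᵘ
a /2^ d = mkℚᵘ (ℤ.+ a) (pred (2 ^ d))

/2^-≤ : ∀ {a b} d e → a * 2 ^ e ≤ b * 2 ^ d → a /2^ d ℚ.≤ b /2^ e
/2^-≤ {a} {b} d e le = *≤* (subst₂ ℤ._≤_ (cross a e) (cross b d) (ℤ.+≤+ le))
  where
  cross : ∀ x f → ℤ.+ (x * 2 ^ f) ≡ ℤ.+ x ℤ.* ℚ.↧ (x /2^ f)
  cross x f = trans (cong (λ k → ℤ.+ (x * k)) (sym (suc-pred (2 ^ f) {{m^n≢0 2 f}}))) (ℤP.pos-* x _)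

/2^-+ : ∀ a b d → a /2^ d ℚ.+ b /2^ d ℚ.≃ (a + b) /2^ d
/2^-+ a b d = *≡* (begin
  (ℤ.+ a ℤ.* ℤ.+ D ℤ.+ ℤ.+ b ℤ.* ℤ.+ D) ℤ.* ℤ.+ D ≡⟨ cong (ℤ._* ℤ.+ D) (ℤP.*-distribʳ-+ (ℤ.+ D) (ℤ.+ a) (ℤ.+ b)) ⟨
  (ℤ.+ a ℤ.+ ℤ.+ b) ℤ.* ℤ.+ D ℤ.* ℤ.+ D         ≡⟨ ℤP.*-assoc (ℤ.+ a ℤ.+ ℤ.+ b) (ℤ.+ D) (ℤ.+ D) ⟩
  (ℤ.+ a ℤ.+ ℤ.+ b) ℤ.* (ℤ.+ D ℤ.* ℤ.+ D)       ≡⟨ cong₂ ℤ._*_ (ℤP.pos-+ a b) (ℤP.pos-* D D) ⟨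
  ℤ.+ (a + b) ℤ.* ℤ.+ (D * D)               ∎)
  where
  open ≡-Reasoning
  D = suc (pred (2 ^ d))

pow2neg≃1/2^ : ∀ d → pow2neg d ℚ.≃ 1 /2^ d
pow2neg≃1/2^ zero    = ℚP.≃-refl
pow2neg≃1/2^ (suc d) = ℚP.≃-trans (ℚP.*-congˡ {half} (pow2neg≃1/2^ d)) (*≡* (begin
  (ℤ.+ 1 ℤ.* ℤ.+ 1) ℤ.* ℚ.↧ (1 /2^ suc d) ≡⟨ ℤP.*-identityˡ _ ⟩
  ℤ.+ suc (pred (2 ^ suc d))            ≡⟨ cong ℤ.+_ (trans (suc-pred (2 ^ suc d) {{m^n≢0 2 (suc d)}}) (cong (2 *_) (sym (suc-pred (2 ^ d) {{m^n≢0 2 d}})))) ⟩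
  ℤ.+ (2 * suc (pred (2 ^ d)))          ≡⟨ ℤP.*-identityˡ _ ⟨
  ℤ.+ 1 ℤ.* ℤ.+ (2 * suc (pred (2 ^ d)))  ∎))
  where open ≡-Reasoning

pow2neg-nonneg : ∀ d → 0ℚᵘ ℚ.≤ pow2neg d
pow2neg-nonneg d = ℚP.≤-respʳ-≃ (ℚP.≃-sym (pow2neg≃1/2^ d)) (/2^-≤ 0 d z≤n)

pow2neg-suc-+ : ∀ d → pow2neg (suc d) ℚ.+ pow2neg (suc d) ℚ.≃ pow2neg d
pow2neg-suc-+ d = ℚP.≃-trans (ℚP.≃-sym (ℚP.*-distribʳ-+ (pow2neg d) half half))
                             (ℚP.≃-trans (ℚP.*-congʳ {pow2neg d} {half ℚ.+ half} {ℚ.1ℚᵘ} (*≡* refl)) (ℚP.*-identityˡ (pow2neg d)))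

listMass : List (List Bool) → ℚᵘ
listMass []       = 0ℚᵘ
listMass (w ∷ ws) = pow2neg (len w) ℚ.+ listMass ws

len-toList : ∀ {ℓ} (w : Vec Bool ℓ) → len (toList w) ≡ ℓ
len-toList []      = refl
len-toList (b ∷ w) = cong suc (len-toList w)

listMass-equal-lengths : ∀ ℓ (ws : List (Vec Bool ℓ)) → listMass (List.map toList ws) ℚ.≃ length ws /2^ ℓ
listMass-equal-lengths ℓ []       = *≡* refl
listMass-equal-lengths ℓ (w ∷ ws) = ℚP.≃-trans
  (ℚP.+-cong (ℚP.≃-trans (ℚP.≃-reflexive (cong pow2neg (len-toList w))) (pow2neg≃1/2^ ℓ)) (listMass-equal-lengths ℓ ws))
  (/2^-+ 1 (length ws) ℓ)

listMass-equal-lengths-≤ : ∀ ℓ e (ws : List (Vec Bool ℓ)) → length ws * 2 ^ e ≤ 2 ^ ℓ →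
                           listMass (List.map toList ws) ℚ.≤ pow2neg e
listMass-equal-lengths-≤ ℓ e ws few = ℚP.≤-respˡ-≃ (ℚP.≃-sym (listMass-equal-lengths ℓ ws))
  (ℚP.≤-respʳ-≃ (ℚP.≃-sym (pow2neg≃1/2^ e)) (/2^-≤ ℓ e (subst (length ws * 2 ^ e ≤_) (sym (*-identityˡ (2 ^ ℓ))) few)))

+-nonneg : ∀ {p q} → 0ℚᵘ ℚ.≤ p → 0ℚᵘ ℚ.≤ q → 0ℚᵘ ℚ.≤ p ℚ.+ q
+-nonneg 0≤p 0≤q = ℚP.≤-respˡ-≃ (ℚP.+-identityʳ 0ℚᵘ) (ℚP.+-mono-≤ 0≤p 0≤q)

listMass-nonneg : ∀ ws → 0ℚᵘ ℚ.≤ listMass ws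
listMass-nonneg []       = ℚP.≤-refl
listMass-nonneg (w ∷ ws) = +-nonneg (pow2neg-nonneg (len w)) (listMass-nonneg ws)

coverMass-suc : ∀ C N → coverMass C (suc N) ℚ.≃ pow2neg (len (C 0)) ℚ.+ coverMass (C ∘ suc) N
coverMass-suc C zero    =
  ℚP.≃-trans (ℚP.+-identityˡ (pow2neg (len (C 0)))) (ℚP.≃-sym (ℚP.+-identityʳ (pow2neg (len (C 0)))))
coverMass-suc C (suc N) = ℚP.≃-trans (ℚP.+-congˡ (pow2neg (len (C (suc N)))) (coverMass-suc C N))
                                     (ℚP.+-assoc (pow2neg (len (C 0))) (coverMass (C ∘ suc) N) _)

-- Concatenating covers

module Concatenation (k : ℕ) (stage : ℕ → List⁺ (List Bool))
                     (stage-mass : ∀ m → listMass (List⁺.toList (stage m)) ℚ.≤ pow2neg (suc (k + m))) where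

  walk : ℕ → List Bool → List (List Bool) → ℕ → List Bool
  walk m w ws       zero    = w
  walk m w []       (suc i) = walk (suc m) (List⁺.head (stage (suc m))) (List⁺.tail (stage (suc m))) i
  walk m w (v ∷ vs) (suc i) = walk m v vs i

  from : ℕ → ℕ → List Bool
  from m = walk m (List⁺.head (stage m)) (List⁺.tail (stage m))

  cover : ℕ → List Bool
  cover = from 0

  budget : ℕ → ℚᵘ
  budget m = pow2neg (suc (k + m))

  budget-halves : ∀ m → budget (suc m) ℚ.+ budget (suc m) ℚ.≃ budget m
  budget-halves m = subst (λ d → budget (suc m) ℚ.+ budget (suc m) ℚ.≃ pow2neg d) (+-suc k m) (pow2neg-suc-+ (k + suc m))

  coverMass-walk : ∀ N m w ws → coverMass (walk m w ws) N ℚ.≤ listMass (w ∷ ws) ℚ.+ budget m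
  coverMass-walk zero    m w ws       = +-nonneg (listMass-nonneg (w ∷ ws)) (pow2neg-nonneg (suc (k + m)))
  coverMass-walk (suc N) m w []       = ℚP.≤-respˡ-≃ (ℚP.≃-sym (coverMass-suc (walk m w []) N)) (begin
    pow2neg (len w) ℚ.+ coverMass (from (suc m)) N
      ≤⟨ ℚP.+-monoʳ-≤ (pow2neg (len w)) (coverMass-walk N (suc m) _ _) ⟩
    pow2neg (len w) ℚ.+ (listMass (List⁺.toList (stage (suc m))) ℚ.+ budget (suc m))
      ≤⟨ ℚP.+-monoʳ-≤ (pow2neg (len w)) (ℚP.+-monoˡ-≤ (budget (suc m)) (stage-mass (suc m))) ⟩
    pow2neg (len w) ℚ.+ (budget (suc m) ℚ.+ budget (suc m))
      ≃⟨ ℚP.+-congʳ (pow2neg (len w)) (budget-halves m) ⟩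
    pow2neg (len w) ℚ.+ budget m
      ≃⟨ ℚP.+-congˡ (budget m) (ℚP.≃-sym (ℚP.+-identityʳ (pow2neg (len w)))) ⟩
    listMass (w ∷ []) ℚ.+ budget m ∎)
    where open ℚP.≤-Reasoning
  coverMass-walk (suc N) m w (v ∷ vs) = ℚP.≤-respˡ-≃ (ℚP.≃-sym (coverMass-suc (walk m w (v ∷ vs)) N)) (begin
    pow2neg (len w) ℚ.+ coverMass (walk m v vs) N
      ≤⟨ ℚP.+-monoʳ-≤ (pow2neg (len w)) (coverMass-walk N m v vs) ⟩
    pow2neg (len w) ℚ.+ (listMass (v ∷ vs) ℚ.+ budget m)
      ≃⟨ ℚP.+-assoc (pow2neg (len w)) (listMass (v ∷ vs)) (budget m) ⟨
    listMass (w ∷ v ∷ vs) ℚ.+ budget m ∎)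
    where open ℚP.≤-Reasoning

  coverMass-cover : ∀ N → coverMass cover N ℚ.≤ pow2neg k
  coverMass-cover N = begin
    coverMass cover N                          ≤⟨ coverMass-walk N 0 _ _ ⟩
    listMass (List⁺.toList (stage 0)) ℚ.+ budget 0 ≤⟨ ℚP.+-monoˡ-≤ (budget 0) (stage-mass 0) ⟩
    budget 0 ℚ.+ budget 0                      ≃⟨ subst (λ d → budget 0 ℚ.+ budget 0 ℚ.≃ pow2neg d) (+-identityʳ k) (pow2neg-suc-+ (k + 0)) ⟩
    pow2neg k                                  ∎
    where open ℚP.≤-Reasoning

  walk-skips : ∀ m w ws → ∃[ i ] ∀ j → walk m w ws (i + j) ≡ from (suc m) j
  walk-skips m w []       = 1 , λ j → refl
  walk-skips m w (v ∷ vs) with i , skips ← walk-skips m v vs = suc i , skips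

  cover-reaches : ∀ m → ∃[ i ] ∀ j → cover (i + j) ≡ from m j
  cover-reaches zero    = 0 , λ j → refl
  cover-reaches (suc m) with i , reaches ← cover-reaches m | i′ , skips ← walk-skips m _ _ =
    i + i′ , λ j → trans (cong cover (+-assoc i i′ j)) (trans (reaches (i′ + j)) (skips j))

  walk-visits : ∀ m {v} w ws → v ∈ w ∷ ws → ∃[ j ] walk m w ws j ≡ v
  walk-visits m w ws       (here refl)  = 0 , refl
  walk-visits m w (u ∷ us) (there v∈) with j , visits ← walk-visits m u us v∈ = suc j , visits

  cover-onto : ∀ m {v} → v ∈ List⁺.toList (stage m) → ∃[ i ] cover i ≡ v
  cover-onto m v∈ with i , reaches ← cover-reaches m | j , visits ← walk-visits m _ _ v∈ =
    i + j , trans (reaches j) visits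

diagonal-step : ℕ × ℕ → ℕ × ℕ
diagonal-step (x , zero)  = 0 , suc x
diagonal-step (x , suc y) = suc x , y

unpair : ℕ → ℕ × ℕ
unpair zero    = 0 , 0
unpair (suc m) = diagonal-step (unpair m)

unpair-onto-diagonal : ∀ d x y → x + y ≡ d → ∃[ m ] unpair m ≡ (x , y)
unpair-onto-diagonal zero    zero    zero    _     = 0 , refl
unpair-onto-diagonal d       (suc x) y       x+y≡d
  with m , eq ← unpair-onto-diagonal d x (suc y) (trans (+-suc x y) x+y≡d) = suc m , cong diagonal-step eq
unpair-onto-diagonal (suc d) zero    (suc y) y≡d
  with m , eq ← unpair-onto-diagonal d y zero (trans (+-identityʳ y) (suc-injective y≡d)) = suc m , cong diagonal-step eq

unpair-surjective : ∀ x y → ∃[ m ] unpair m ≡ (x , y)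
unpair-surjective x y = unpair-onto-diagonal (x + y) x y refl

module Stage (k m : ℕ) where
  open TestPattern (proj₁ (unpair m)) (proj₂ (unpair m))
  open Repetition width Success q count-Success

  e : ℕ
  e = suc (suc (k + m))

  K : ℕ
  K = 2 ^ q * e

  failures : List (Vec Bool (offset K))
  failures = satisfying (offset K) (AllFail K)

  -- The leading string only makes the list nonempty; its mass 2^-e fits in the budget.
  cylinders : List⁺ (List Bool)
  cylinders = toList (replicate e false) ∷ List.map toList failures

  cylinders-mass : listMass (List⁺.toList cylinders) ℚ.≤ pow2neg (suc (k + m))
  cylinders-mass = begin
    pow2neg (len (toList (replicate e false))) ℚ.+ listMass (List.map toList failures)
      ≤⟨ ℚP.+-mono-≤ (ℚP.≤-reflexive (ℚP.≃-reflexive (cong pow2neg (len-toList (replicate e false)))))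
                     (listMass-equal-lengths-≤ (offset K) e failures few-failures) ⟩
    pow2neg e ℚ.+ pow2neg e
      ≃⟨ pow2neg-suc-+ (suc (k + m)) ⟩
    pow2neg (suc (k + m)) ∎
    where
    open ℚP.≤-Reasoning
    few-failures : length failures * 2 ^ e ≤ 2 ^ offset K
    few-failures = subst (λ c → c * 2 ^ e ≤ 2 ^ offset K) (sym (length-satisfying (offset K) (AllFail K)))
                         (count-AllFail-2^q*e e)

  avoids⇒Matches : ∀ R → (∀ {w} → w ∈ List⁺.toList cylinders → ¬ Prefix w R) → ∃[ L ] Matches R L
  avoids⇒Matches R avoided = offset (proj₁ succeeded) , Success⇒Matches (offset (proj₁ succeeded)) R (proj₂ succeeded)
    where
    not-failed : ¬ T (AllFail K (prefix (offset K) R))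
    not-failed failed =
      avoided (there (∈-map⁺ toList (∈-satisfying (offset K) (AllFail K) failed))) (Prefix-prefix (offset K) R)
    succeeded = ¬AllFail⇒Success K R not-failed

module Cover (k : ℕ) = Concatenation k (Stage.cylinders k) (Stage.cylinders-mass k)

avoids-cover⇒patterns : ∀ k R → (∀ i → ¬ Prefix (Cover.cover k i) R) → ∀ n a → ∃[ L ] TestPattern.Matches n a R L
avoids-cover⇒patterns k R avoided n a =
  subst (λ (n , a) → ∃[ L ] TestPattern.Matches n a R L) unpair-m≡n,a (Stage.avoids⇒Matches k m R avoids-stage)
  where
  m = proj₁ (unpair-surjective n a)
  unpair-m≡n,a = proj₂ (unpair-surjective n a)
  avoids-stage : ∀ {w} → w ∈ List⁺.toList (Stage.cylinders k m) → ¬ Prefix w R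
  avoids-stage w∈ =
    subst (λ w → ¬ Prefix w R) (proj₂ (Cover.cover-onto k m w∈)) (avoided (proj₁ (Cover.cover-onto k m w∈)))

proposition37 : ∀ (k : ℕ) →
    Σ[ C ∈ (ℕ → List Bool) ]
      ((∀ (N : ℕ) → coverMass C N ℚ.≤ pow2neg k) ×
       (∀ (R : SubsetN) → (∀ (i : ℕ) → ¬ Prefix (C i) R) → Rich R))
proposition37 k =
  Cover.cover k , Cover.coverMass-cover k , λ R avoided → patterns⇒Rich R (avoids-cover⇒patterns k R avoided)
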